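{- Let $X=\{X_1,X_2\}$ be a $\lambda_2$-equitable $2$-partition of $J(n,3)$ with quotient matrix $(p_{ij})$ satisfying $p_{11}\geq p_{22}$ and $p_{11}\geq 2n-7$. Let $\{a,b,c\}$ be a vertex with $\overline{abc}=1$, labelled so that $\overline{ab\ast}\geq\overline{ac\ast}\geq\overline{bc\ast}$, and suppose $\overline{ab\ast}=\overline{ac\ast}$ and $\overline{ac\ast}-\overline{bc\ast}=n-4$. Then $\overline{abd}=\overline{acd}=1$ for every $d\in[n]\setminus\{a,b,c\}$, and there is exactly one $d\in[n]\setminus\{a,b,c\}$ with $\overline{bcd}=1$.
   Context: $J(n,3)$ ($n\geq 6$): vertices are the $3$-subsets of $[n]$, adjacent iff they share exactly two elements; it is $3(n-3)$-regular. An equitable $2$-partition with quotient matrix $(p_{ij})$ means each vertex of $X_i$ has exactly $p_{ij}$ neighbours in $X_j$; $\lambda_2$-equitable means $p_{11}-p_{21}=n-7$. $\overline{u}=1$ if $u\in X_1$, else $0$; $\overline{xyz}=\overline{\{x,y,z\}}$; $\overline{ij\ast}$ is the number of $3$-subsets containing $i,j$ lying in $X_1$. -}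

module Defs where

open import Data.Nat using (ℕ; zero; suc; _+_; _*_; _≤_; _≡ᵇ_)
open import Data.Bool using (Bool; true; false; _∧_; if_then_else_)
open import Data.List using (List; []; _∷_; map; _++_; filter; length)
open import Data.Vec using (_∷_; []; lookup)
open import Data.Fin using (Fin)
open import Data.Fin.Subset using (Subset; ∣_∣; _∩_; _∪_; ⁅_⁆; _∉_)
open import Data.Product using (Σ; _×_; ∃; _,_)
open import Relation.Binary.PropositionalEquality using (_≡_)

allSubsets : (n : ℕ) → List (Subset n)
allSubsets zero = [] ∷ []
allSubsets (suc n) = map (true ∷_) (allSubsets n) ++ map (false ∷_) (allSubsets n)

countᵇ : {A : Set} → (A → Bool) → List A → ℕ
countᵇ p [] = 0
countᵇ p (x ∷ xs) = (if p x then 1 else 0) + countᵇ p xs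

isVertexᵇ : {n : ℕ} → Subset n → Bool
isVertexᵇ s = ∣ s ∣ ≡ᵇ 3

adjᵇ : {n : ℕ} → Subset n → Subset n → Bool
adjᵇ s t = ∣ s ∩ t ∣ ≡ᵇ 2

-- A 2-partition {X₁,X₂} of V(J(n,3)) is given by a colouring col:
-- a vertex u lies in X₁ iff col u ≡ true (so col u is \overline{u}),
-- and in X₂ iff col u ≡ false.  (Values of col on non-3-subsets are irrelevant.)
Colouring : ℕ → Set
Colouring n = Subset n → Bool

nbrsIn : {n : ℕ} → Colouring n → Bool → Subset n → ℕ
nbrsIn {n} col true  s =
  countᵇ (λ t → isVertexᵇ t ∧ adjᵇ s t ∧ col t) (allSubsets n)
nbrsIn {n} col false s =
  countᵇ (λ t → isVertexᵇ t ∧ adjᵇ s t ∧ (if col t then false else true)) (allSubsets n)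

IsTwoPartition : {n : ℕ} → Colouring n → Set
IsTwoPartition {n} col =
  (Σ (Subset n) λ u → ∣ u ∣ ≡ 3 × col u ≡ true) ×
  (Σ (Subset n) λ u → ∣ u ∣ ≡ 3 × col u ≡ false)

IsEquitable : {n : ℕ} → Colouring n → ℕ → ℕ → ℕ → ℕ → Set
IsEquitable {n} col p11 p12 p21 p22 =
  IsTwoPartition col ×
  (∀ (u : Subset n) → ∣ u ∣ ≡ 3 → col u ≡ true →
     nbrsIn col true u ≡ p11 × nbrsIn col false u ≡ p12) ×
  (∀ (u : Subset n) → ∣ u ∣ ≡ 3 → col u ≡ false →
     nbrsIn col true u ≡ p21 × nbrsIn col false u ≡ p22)

-- λ₂-equitable: p11 − p21 = n − 7 (stated additively, in ℕ, to avoid truncated subtraction).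
IsLambda2Equitable : {n : ℕ} → Colouring n → ℕ → ℕ → ℕ → ℕ → Set
IsLambda2Equitable {n} col p11 p12 p21 p22 =
  IsEquitable col p11 p12 p21 p22 × p11 + 7 ≡ p21 + n

triple : {n : ℕ} → Fin n → Fin n → Fin n → Subset n
triple x y z = ⁅ x ⁆ ∪ (⁅ y ⁆ ∪ ⁅ z ⁆)

pairCount : {n : ℕ} → Colouring n → Fin n → Fin n → ℕ
pairCount {n} col i j =
  countᵇ (λ t → isVertexᵇ t ∧ lookup t i ∧ lookup t j ∧ col t) (allSubsets n)

-- Every X₁-neighbour of the vertex abc meets it in exactly one of the pairs ab, ac, bc.
-- Writing D_xy for the number of d ∉ {a,b,c} with xyd ∈ X₁, this gives p11 = D_ab + D_ac + D_bc,
-- and, since abc ∈ X₁ itself, the pair count of xy is D_xy + 1. Each D_xy is at most n − 3.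
-- The hypotheses turn into D_ab = D_ac = D_bc + (n − 4) ≤ n − 3, so D_bc ≤ 1, while
-- 2n − 7 ≤ p11 = 3 D_bc + 2n − 8 forces D_bc ≥ 1. Hence D_bc = 1 and D_ab = D_ac = n − 3,
-- which is exactly the statement.
module Submission where

open import Data.Bool using (Bool; true; false; not; _∧_; _∨_; if_then_else_)
open import Data.Bool.Properties using (T-≡; not-¬; T?; ∨-zeroʳ)
open import Data.Empty using (⊥-elim)
open import Data.Fin using (Fin; zero; suc; _≟_)
open import Data.Fin.Subset using (Subset; ∣_∣; ⁅_⁆; _∪_; _∩_; ∁)
open import Data.Fin.Subset.Properties using (∪-comm; ∪-assoc; ∩-idem; ∣∁p∣≡n∸∣p∣)
open import Data.List using (List; []; _∷_; map; length; filterᵇ; tabulate; allFin)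
open import Data.List.Properties using (length-map; map-tabulate)
open import Data.List.Membership.Propositional using (_∈_)
open import Data.List.Membership.Propositional.Properties
  using (∈-map⁺; ∈-map⁻; ∈-filter⁺; ∈-filter⁻; ∈-allFin; ∈-++⁺ˡ; ∈-++⁺ʳ)
open import Data.List.Membership.Propositional.Properties.WithK using (unique∧set⇒bag)
open import Data.List.Relation.Binary.BagAndSetEquality using (∼bag⇒↭)
open import Data.List.Relation.Binary.Disjoint.Propositional using (Disjoint)
open import Data.List.Relation.Binary.Permutation.Propositional.Properties using (↭-length)
import Data.List.Relation.Unary.All as All
import Data.List.Relation.Unary.All.Properties as All
open import Data.List.Relation.Unary.Any using (here; there)
open import Data.List.Relation.Unary.Unique.Propositional using (Unique; []; _∷_)
open import Data.List.Relation.Unary.Unique.Propositional.Properties using (filter⁺; map⁺; ++⁺; allFin⁺)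
open import Data.Nat using (ℕ; zero; suc; _+_; _*_; _∸_; _≤_; _<_; _≡ᵇ_; z≤n; s≤s)
open import Data.Nat.Properties
  using (+-commutativeSemigroup; +-identityʳ; +-mono-≤; +-mono-≤-<; suc-injective; ≤-trans; <-irrefl;
         1+n≰n; m≤n+m; ≡ᵇ⇒≡)
open import Data.Nat.Solver using (module +-*-Solver)
open import Algebra.Properties.CommutativeSemigroup +-commutativeSemigroup using (interchange)
open import Data.Product using (Σ; _×_; ∃; _,_; proj₁; proj₂; uncurry)
open import Data.Sum using (_⊎_; inj₁; inj₂)
open import Data.Vec using (_∷_; []; lookup)
open import Data.Vec.Properties
  using (lookup-map; lookup-replicate; lookup-zipWith; tabulate∘lookup; tabulate-cong; ∷-injectiveʳ)
open import Function using (_∘_; id; Equivalence; mk⇔)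
open import Relation.Binary.PropositionalEquality
  using (_≡_; _≢_; ≢-sym; refl; sym; trans; cong; cong₂; subst; subst₂; module ≡-Reasoning)
open import Relation.Nullary using (does; yes; no)
open import Relation.Nullary.Decidable using (dec-true; dec-false)

open import Defs

-- Counting with Boolean predicates

private variable
  A B : Set
  p q r s : A → Bool
  x : A
  xs : List A

⟦_⟧ : Bool → ℕ
⟦ b ⟧ = if b then 1 else 0

countᵇ-cong : (∀ x → p x ≡ q x) → (xs : List A) → countᵇ p xs ≡ countᵇ q xs
countᵇ-cong p≗q []       = refl
countᵇ-cong p≗q (x ∷ xs) = cong₂ (λ b m → ⟦ b ⟧ + m) (p≗q x) (countᵇ-cong p≗q xs)

countᵇ-map : (f : B → A) (xs : List B) → countᵇ p (map f xs) ≡ countᵇ (p ∘ f) xs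
countᵇ-map f []       = refl
countᵇ-map f (x ∷ xs) = cong (⟦ _ ⟧ +_) (countᵇ-map f xs)

countᵇ-false : (xs : List A) → countᵇ (λ _ → false) xs ≡ 0
countᵇ-false []       = refl
countᵇ-false (x ∷ xs) = countᵇ-false xs

countᵇ-+ : (∀ x → ⟦ p x ⟧ ≡ ⟦ q x ⟧ + ⟦ r x ⟧) →
           (xs : List A) → countᵇ p xs ≡ countᵇ q xs + countᵇ r xs
countᵇ-+ split []       = refl
countᵇ-+ {q = q} {r = r} split (x ∷ xs) = begin
  ⟦ _ ⟧ + countᵇ _ xs                                    ≡⟨ cong₂ _+_ (split x) (countᵇ-+ split xs) ⟩
  (⟦ q x ⟧ + ⟦ r x ⟧) + (countᵇ q xs + countᵇ r xs)     ≡⟨ interchange ⟦ q x ⟧ ⟦ r x ⟧ _ _ ⟩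
  (⟦ q x ⟧ + countᵇ q xs) + (⟦ r x ⟧ + countᵇ r xs)     ∎
  where open ≡-Reasoning

countᵇ-+₃ : (∀ x → ⟦ p x ⟧ ≡ ⟦ q x ⟧ + ⟦ r x ⟧ + ⟦ s x ⟧) →
            (xs : List A) → countᵇ p xs ≡ countᵇ q xs + countᵇ r xs + countᵇ s xs
countᵇ-+₃ split []       = refl
countᵇ-+₃ {q = q} {r = r} {s = s} split (x ∷ xs) = begin
  ⟦ _ ⟧ + countᵇ _ xs
    ≡⟨ cong₂ _+_ (split x) (countᵇ-+₃ split xs) ⟩
  (⟦ q x ⟧ + ⟦ r x ⟧ + ⟦ s x ⟧) + (countᵇ q xs + countᵇ r xs + countᵇ s xs)
    ≡⟨ interchange (⟦ q x ⟧ + ⟦ r x ⟧) ⟦ s x ⟧ (countᵇ q xs + countᵇ r xs) _ ⟩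
  (⟦ q x ⟧ + ⟦ r x ⟧ + (countᵇ q xs + countᵇ r xs)) + (⟦ s x ⟧ + countᵇ s xs)
    ≡⟨ cong (_+ (⟦ s x ⟧ + countᵇ s xs)) (interchange ⟦ q x ⟧ ⟦ r x ⟧ (countᵇ q xs) _) ⟩
  (⟦ q x ⟧ + countᵇ q xs) + (⟦ r x ⟧ + countᵇ r xs) + (⟦ s x ⟧ + countᵇ s xs) ∎
  where open ≡-Reasoning

not-∧⁻ : ∀ {a b} → not a ∧ b ≡ true → a ≡ false × b ≡ true
not-∧⁻ {false} h = refl , h

⟦⟧-mono : ∀ {b c} → (b ≡ true → c ≡ true) → ⟦ b ⟧ ≤ ⟦ c ⟧
⟦⟧-mono {false} b⇒c = z≤n
⟦⟧-mono {true}  b⇒c rewrite b⇒c refl = s≤s z≤n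

countᵇ-mono : (∀ x → q x ≡ true → p x ≡ true) → (xs : List A) → countᵇ q xs ≤ countᵇ p xs
countᵇ-mono q⇒p []       = z≤n
countᵇ-mono q⇒p (x ∷ xs) = +-mono-≤ (⟦⟧-mono (q⇒p x)) (countᵇ-mono q⇒p xs)

countᵇ-mono-< : (∀ x → q x ≡ true → p x ≡ true) →
                x ∈ xs → q x ≡ false → p x ≡ true → countᵇ q xs < countᵇ p xs
countᵇ-mono-< {xs = y ∷ ys} q⇒p (here refl) qx px rewrite qx | px = s≤s (countᵇ-mono q⇒p ys)
countᵇ-mono-< {xs = y ∷ ys} q⇒p (there x∈ys) qx px =
  +-mono-≤-< (⟦⟧-mono (q⇒p y)) (countᵇ-mono-< q⇒p x∈ys qx px)

countᵇ-mono-≡ : (∀ x → q x ≡ true → p x ≡ true) → countᵇ q xs ≡ countᵇ p xs →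
                x ∈ xs → p x ≡ true → q x ≡ true
countᵇ-mono-≡ {q = q} {x = x} q⇒p eq x∈xs px with q x in qx
... | true  = refl
... | false = ⊥-elim (<-irrefl eq (countᵇ-mono-< q⇒p x∈xs qx px))

countᵇ≡1⇒unique : countᵇ p xs ≡ 1 →
                  ∃ λ x → x ∈ xs × p x ≡ true × (∀ {y} → y ∈ xs → p y ≡ true → y ≡ x)
countᵇ≡1⇒unique {p = p} {xs = x ∷ xs} one with p x in px
... | true  = x , here refl , px , λ
  { (here refl) _  → refl
  ; (there y∈xs) py → ⊥-elim (<-irrefl (sym (suc-injective one))
                        (subst (_< countᵇ p xs) (countᵇ-false xs) (countᵇ-mono-< (λ _ ()) y∈xs refl py))) }
... | false with countᵇ≡1⇒unique one
...   | z , z∈xs , pz , unique = z , there z∈xs , pz , λ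
  { (here refl) py → ⊥-elim (not-¬ px py)
  ; (there y∈xs) py → unique y∈xs py }

countᵇ≡length-filterᵇ : (xs : List A) → countᵇ p xs ≡ length (filterᵇ p xs)
countᵇ≡length-filterᵇ []       = refl
countᵇ≡length-filterᵇ {p = p} (x ∷ xs) with p x
... | true  = cong suc (countᵇ≡length-filterᵇ xs)
... | false = countᵇ≡length-filterᵇ xs

private
  Unique-map⁺ : (f : B → A) {ys : List B} →
                (∀ {y y′} → y ∈ ys → y′ ∈ ys → f y ≡ f y′ → y ≡ y′) → Unique ys → Unique (map f ys)
  Unique-map⁺ f injective []            = []
  Unique-map⁺ f injective (y∉ys ∷ ys!) =
    All.map⁺ (All.tabulate λ y′∈ys fy≡fy′ →
                All.lookup y∉ys y′∈ys (injective (here refl) (there y′∈ys) fy≡fy′))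
    ∷ Unique-map⁺ f (λ y∈ys y′∈ys → injective (there y∈ys) (there y′∈ys)) ys!

countᵇ-image : (f : B → A) {xs : List A} {ys : List B} → Unique xs → Unique ys →
  (∀ {y} → y ∈ ys → q y ≡ true → f y ∈ xs × p (f y) ≡ true) →
  (∀ {y y′} → q y ≡ true → q y′ ≡ true → f y ≡ f y′ → y ≡ y′) →
  (∀ {x} → x ∈ xs → p x ≡ true → ∃ λ y → y ∈ ys × q y ≡ true × f y ≡ x) →
  countᵇ p xs ≡ countᵇ q ys
countᵇ-image {q = q} {p = p} f {xs} {ys} xs! ys! into injective onto = begin
  countᵇ p xs                    ≡⟨ countᵇ≡length-filterᵇ xs ⟩
  length (filterᵇ p xs)
    ≡⟨ ↭-length (∼bag⇒↭ (unique∧set⇒bag (filter⁺ (T? ∘ p) xs!) image! (mk⇔ to from))) ⟩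
  length (map f (filterᵇ q ys))  ≡⟨ length-map f (filterᵇ q ys) ⟩
  length (filterᵇ q ys)          ≡⟨ countᵇ≡length-filterᵇ ys ⟨
  countᵇ q ys                    ∎
  where
  open ≡-Reasoning
  filtered⁻ : ∀ {y} → y ∈ filterᵇ q ys → y ∈ ys × q y ≡ true
  filtered⁻ y∈ with y∈ys , qy ← ∈-filter⁻ (T? ∘ q) y∈ = y∈ys , Equivalence.to T-≡ qy
  image! : Unique (map f (filterᵇ q ys))
  image! = Unique-map⁺ f (λ y∈ y′∈ → injective (proj₂ (filtered⁻ y∈)) (proj₂ (filtered⁻ y′∈)))
                         (filter⁺ (T? ∘ q) ys!)
  to : ∀ {x} → x ∈ filterᵇ p xs → x ∈ map f (filterᵇ q ys)
  to x∈ with x∈xs , px ← ∈-filter⁻ (T? ∘ p) x∈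
       with y , y∈ys , qy , refl ← onto x∈xs (Equivalence.to T-≡ px)
       = ∈-map⁺ f (∈-filter⁺ (T? ∘ q) y∈ys (Equivalence.from T-≡ qy))
  from : ∀ {x} → x ∈ map f (filterᵇ q ys) → x ∈ filterᵇ p xs
  from x∈ with y , y∈ , refl ← ∈-map⁻ f x∈
         with fy∈xs , pfy ← uncurry into (filtered⁻ y∈)
         = ∈-filter⁺ (T? ∘ p) fy∈xs (Equivalence.from T-≡ pfy)

countᵇ-allFin-suc : ∀ {n} (p : Fin (suc n) → Bool) →
                    countᵇ p (allFin (suc n)) ≡ ⟦ p zero ⟧ + countᵇ (p ∘ suc) (allFin n)
countᵇ-allFin-suc {n} p = cong (⟦ p zero ⟧ +_) (begin
  countᵇ p (tabulate suc)           ≡⟨ cong (countᵇ p) (map-tabulate id suc) ⟨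
  countᵇ p (map suc (allFin n))     ≡⟨ countᵇ-map suc (allFin n) ⟩
  countᵇ (p ∘ suc) (allFin n)       ∎)
  where open ≡-Reasoning

infix 4 _≟ᵇ_
_≟ᵇ_ : ∀ {n} → Fin n → Fin n → Bool
i ≟ᵇ j = does (i ≟ j)

countᵇ-select : ∀ {n} (a : Fin n) (g : Fin n → Bool) →
                countᵇ (λ i → (i ≟ᵇ a) ∧ g i) (allFin n) ≡ ⟦ g a ⟧
countᵇ-select {suc n} zero g = begin
  countᵇ (λ i → (i ≟ᵇ zero) ∧ g i) (allFin (suc n))  ≡⟨ countᵇ-allFin-suc (λ i → (i ≟ᵇ zero) ∧ g i) ⟩
  ⟦ g zero ⟧ + countᵇ (λ _ → false) (allFin n)      ≡⟨ cong (⟦ g zero ⟧ +_) (countᵇ-false (allFin n)) ⟩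
  ⟦ g zero ⟧ + 0                                    ≡⟨ +-identityʳ _ ⟩
  ⟦ g zero ⟧                                        ∎
  where open ≡-Reasoning
countᵇ-select {suc n} (suc a) g =
  trans (countᵇ-allFin-suc (λ i → (i ≟ᵇ suc a) ∧ g i)) (countᵇ-select a (g ∘ suc))

∣∣≡countᵇ-lookup : ∀ {n} (s : Subset n) → ∣ s ∣ ≡ countᵇ (lookup s) (allFin n)
∣∣≡countᵇ-lookup []          = refl
∣∣≡countᵇ-lookup (true ∷ s)  =
  trans (cong suc (∣∣≡countᵇ-lookup s)) (sym (countᵇ-allFin-suc (lookup (true ∷ s))))
∣∣≡countᵇ-lookup (false ∷ s) =
  trans (∣∣≡countᵇ-lookup s) (sym (countᵇ-allFin-suc (lookup (false ∷ s))))

-- 3-subsets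

lookup-⁅⁆ : ∀ {n} (x i : Fin n) → lookup ⁅ x ⁆ i ≡ (i ≟ᵇ x)
lookup-⁅⁆ zero    zero    = refl
lookup-⁅⁆ zero    (suc i) = lookup-replicate i false
lookup-⁅⁆ (suc x) zero    = refl
lookup-⁅⁆ (suc x) (suc i) = lookup-⁅⁆ x i

module _ {n : ℕ} (x y z : Fin n) where

  lookup-triple : ∀ i → lookup (triple x y z) i ≡ (i ≟ᵇ x) ∨ (i ≟ᵇ y) ∨ (i ≟ᵇ z)
  lookup-triple i = begin
    lookup (⁅ x ⁆ ∪ (⁅ y ⁆ ∪ ⁅ z ⁆)) i
      ≡⟨ lookup-zipWith _∨_ i ⁅ x ⁆ _ ⟩
    lookup ⁅ x ⁆ i ∨ lookup (⁅ y ⁆ ∪ ⁅ z ⁆) i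
      ≡⟨ cong₂ _∨_ (lookup-⁅⁆ x i) (lookup-zipWith _∨_ i ⁅ y ⁆ _) ⟩
    (i ≟ᵇ x) ∨ lookup ⁅ y ⁆ i ∨ lookup ⁅ z ⁆ i
      ≡⟨ cong ((i ≟ᵇ x) ∨_) (cong₂ _∨_ (lookup-⁅⁆ y i) (lookup-⁅⁆ z i)) ⟩
    (i ≟ᵇ x) ∨ (i ≟ᵇ y) ∨ (i ≟ᵇ z)
      ∎
    where open ≡-Reasoning

  triple-∋₁ : lookup (triple x y z) x ≡ true
  triple-∋₁ rewrite lookup-triple x | dec-true (x ≟ x) refl = refl

  triple-∋₂ : lookup (triple x y z) y ≡ true
  triple-∋₂ rewrite lookup-triple y | dec-true (y ≟ y) refl = ∨-zeroʳ (y ≟ᵇ x)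

  triple-∋₃ : lookup (triple x y z) z ≡ true
  triple-∋₃ rewrite lookup-triple z | dec-true (z ≟ z) refl | ∨-zeroʳ (z ≟ᵇ y) = ∨-zeroʳ (z ≟ᵇ x)

  triple-swap : triple x z y ≡ triple x y z
  triple-swap = cong (⁅ x ⁆ ∪_) (∪-comm ⁅ z ⁆ ⁅ y ⁆)

  triple-rotate : triple y z x ≡ triple x y z
  triple-rotate = trans (sym (∪-assoc ⁅ y ⁆ ⁅ z ⁆ ⁅ x ⁆)) (∪-comm (⁅ y ⁆ ∪ ⁅ z ⁆) ⁅ x ⁆)

module _ {n : ℕ} {x y z : Fin n} where

  triple-∋⁻ : ∀ {i} → lookup (triple x y z) i ≡ true → i ≡ x ⊎ i ≡ y ⊎ i ≡ z
  triple-∋⁻ {i} i∈ rewrite lookup-triple x y z i with i ≟ x | i ≟ y | i ≟ z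
  ... | yes i≡x | _       | _       = inj₁ i≡x
  ... | no _    | yes i≡y | _       = inj₂ (inj₁ i≡y)
  ... | no _    | no _    | yes i≡z = inj₂ (inj₂ i≡z)

  triple-∌ : ∀ {i} → i ≢ x → i ≢ y → i ≢ z → lookup (triple x y z) i ≡ false
  triple-∌ {i} i≢x i≢y i≢z rewrite lookup-triple x y z i
    | dec-false (i ≟ x) i≢x | dec-false (i ≟ y) i≢y | dec-false (i ≟ z) i≢z = refl

module _ {n : ℕ} where

  avoidsᵇ : Fin n → Fin n → Fin n → Bool
  avoidsᵇ x y d = not (d ≟ᵇ x) ∧ not (d ≟ᵇ y)

  avoids⁺ : ∀ {x y d} → d ≢ x → d ≢ y → avoidsᵇ x y d ≡ true
  avoids⁺ {x} {y} {d} d≢x d≢y rewrite dec-false (d ≟ x) d≢x | dec-false (d ≟ y) d≢y = refl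

  avoids-∧⁻ : ∀ {x y d b} → avoidsᵇ x y d ∧ b ≡ true → d ≢ x × d ≢ y × b ≡ true
  avoids-∧⁻ {x} {y} {d} h with d ≟ x | d ≟ y
  ... | no d≢x | no d≢y = d≢x , d≢y , h

  ∣∣-split : ∀ {x y} → x ≢ y → (s : Subset n) →
             ∣ s ∣ ≡ ⟦ lookup s x ⟧ + ⟦ lookup s y ⟧ + countᵇ (λ i → avoidsᵇ x y i ∧ lookup s i) (allFin n)
  ∣∣-split {x} {y} x≢y s = begin
    ∣ s ∣                                      ≡⟨ ∣∣≡countᵇ-lookup s ⟩
    countᵇ (lookup s) (allFin n)               ≡⟨ countᵇ-+₃ pointwise (allFin n) ⟩
    countᵇ (λ i → (i ≟ᵇ x) ∧ lookup s i) (allFin n) + countᵇ (λ i → (i ≟ᵇ y) ∧ lookup s i) (allFin n) + rest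
      ≡⟨ cong₂ (λ a b → a + b + rest) (countᵇ-select x (lookup s)) (countᵇ-select y (lookup s)) ⟩
    ⟦ lookup s x ⟧ + ⟦ lookup s y ⟧ + rest   ∎
    where
    open ≡-Reasoning
    rest : ℕ
    rest = countᵇ (λ i → avoidsᵇ x y i ∧ lookup s i) (allFin n)
    pointwise : ∀ i → ⟦ lookup s i ⟧ ≡
      ⟦ (i ≟ᵇ x) ∧ lookup s i ⟧ + ⟦ (i ≟ᵇ y) ∧ lookup s i ⟧ + ⟦ avoidsᵇ x y i ∧ lookup s i ⟧
    pointwise i with i ≟ x | i ≟ y | lookup s i
    ... | yes refl | yes x≡y | _     = ⊥-elim (x≢y x≡y)
    ... | yes refl | no _    | true  = refl
    ... | yes refl | no _    | false = refl
    ... | no _     | yes refl | true  = refl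
    ... | no _     | yes refl | false = refl
    ... | no _     | no _     | _     = refl

module _ {n : ℕ} {x y z : Fin n} (x≢y : x ≢ y) (x≢z : x ≢ z) (y≢z : y ≢ z) where

  private
    T : Subset n
    T = triple x y z

  ∣triple∩∣ : (t : Subset n) → ∣ triple x y z ∩ t ∣ ≡ ⟦ lookup t x ⟧ + ⟦ lookup t y ⟧ + ⟦ lookup t z ⟧
  ∣triple∩∣ t = begin
    ∣ T ∩ t ∣
      ≡⟨ ∣∣-split x≢y (T ∩ t) ⟩
    ⟦ lookup (T ∩ t) x ⟧ + ⟦ lookup (T ∩ t) y ⟧ + rest
      ≡⟨ cong₂ (λ a b → ⟦ a ⟧ + ⟦ b ⟧ + rest) (lookup-T∩ (triple-∋₁ x y z)) (lookup-T∩ (triple-∋₂ x y z)) ⟩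
    ⟦ lookup t x ⟧ + ⟦ lookup t y ⟧ + rest
      ≡⟨ cong (⟦ lookup t x ⟧ + ⟦ lookup t y ⟧ +_)
              (trans (countᵇ-cong third (allFin n)) (countᵇ-select z (lookup t))) ⟩
    ⟦ lookup t x ⟧ + ⟦ lookup t y ⟧ + ⟦ lookup t z ⟧ ∎
    where
    open ≡-Reasoning
    rest : ℕ
    rest = countᵇ (λ i → avoidsᵇ x y i ∧ lookup (T ∩ t) i) (allFin n)
    lookup-T∩ : ∀ {i} → lookup T i ≡ true → lookup (T ∩ t) i ≡ lookup t i
    lookup-T∩ {i} i∈T = trans (lookup-zipWith _∧_ i T t) (cong (_∧ lookup t i) i∈T)
    third : ∀ i → avoidsᵇ x y i ∧ lookup (T ∩ t) i ≡ (i ≟ᵇ z) ∧ lookup t i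
    third i rewrite lookup-zipWith _∧_ i T t | lookup-triple x y z i with i ≟ x | i ≟ y | i ≟ z
    ... | yes refl | _        | yes x≡z = ⊥-elim (x≢z x≡z)
    ... | yes refl | _        | no _    = refl
    ... | no _     | yes refl | yes y≡z = ⊥-elim (y≢z y≡z)
    ... | no _     | yes refl | no _    = refl
    ... | no _     | no _     | yes _   = refl
    ... | no _     | no _     | no _    = refl

  ∣triple∣≡3 : ∣ triple x y z ∣ ≡ 3
  ∣triple∣≡3 = trans (cong ∣_∣ (sym (∩-idem T))) (trans (∣triple∩∣ T) all-in)
    where
    all-in : ⟦ lookup T x ⟧ + ⟦ lookup T y ⟧ + ⟦ lookup T z ⟧ ≡ 3
    all-in rewrite triple-∋₁ x y z | triple-∋₂ x y z | triple-∋₃ x y z = refl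

module _ {n : ℕ} {x y : Fin n} (x≢y : x ≢ y) {t : Subset n} (∣t∣≡3 : ∣ t ∣ ≡ 3)
         (tx : lookup t x ≡ true) (ty : lookup t y ≡ true) where

  countᵇ-third≡1 : countᵇ (λ i → avoidsᵇ x y i ∧ lookup t i) (allFin n) ≡ 1
  countᵇ-third≡1 = suc-injective (suc-injective (trans (sym split) ∣t∣≡3))
    where
    split : ∣ t ∣ ≡ 2 + countᵇ (λ i → avoidsᵇ x y i ∧ lookup t i) (allFin n)
    split = subst₂ (λ a b → ∣ t ∣ ≡ ⟦ a ⟧ + ⟦ b ⟧ + countᵇ (λ i → avoidsᵇ x y i ∧ lookup t i) (allFin n))
                   tx ty (∣∣-split x≢y t)

  triple-through : ∃ λ d → d ≢ x × d ≢ y × t ≡ triple x y d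
  triple-through
    with d , _ , third , unique ← countᵇ≡1⇒unique countᵇ-third≡1
    with d≢x , d≢y , td ← avoids-∧⁻ third
    = d , d≢x , d≢y , trans (sym (tabulate∘lookup t)) (trans (tabulate-cong same) (tabulate∘lookup _))
    where
    same : ∀ i → lookup t i ≡ lookup (triple x y d) i
    same i with i ≟ x | i ≟ y | i ≟ d
    ... | yes refl | _        | _        = trans tx (sym (triple-∋₁ x y d))
    ... | no _     | yes refl | _        = trans ty (sym (triple-∋₂ x y d))
    ... | no _     | no _     | yes refl = trans td (sym (triple-∋₃ x y i))
    ... | no i≢x   | no i≢y   | no i≢d   = trans absent (sym (triple-∌ i≢x i≢y i≢d))
      where
      absent : lookup t i ≡ false
      absent with lookup t i in ti
      ... | false = refl
      ... | true  =
        ⊥-elim (i≢d (unique (∈-allFin i) (trans (cong (_∧ lookup t i) (avoids⁺ i≢x i≢y)) ti)))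

∈-allSubsets : ∀ {n} (s : Subset n) → s ∈ allSubsets n
∈-allSubsets []          = here refl
∈-allSubsets (true ∷ s)  = ∈-++⁺ˡ (∈-map⁺ (true ∷_) (∈-allSubsets s))
∈-allSubsets {suc n} (false ∷ s) =
  ∈-++⁺ʳ (map (true ∷_) (allSubsets n)) (∈-map⁺ (false ∷_) (∈-allSubsets s))

allSubsets! : ∀ n → Unique (allSubsets n)
allSubsets! zero    = All.[] ∷ []
allSubsets! (suc n) =
  ++⁺ (map⁺ ∷-injectiveʳ (allSubsets! n)) (map⁺ ∷-injectiveʳ (allSubsets! n)) disjoint
  where
  disjoint : Disjoint (map (true ∷_) (allSubsets n)) (map (false ∷_) (allSubsets n))
  disjoint (s∈ , s∈′) with _ , _ , refl ← ∈-map⁻ (true ∷_) s∈ with _ , _ , () ← ∈-map⁻ (false ∷_) s∈′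

completesᵇ : ∀ {n} → Fin n → Fin n → (Subset n → Bool) → Fin n → Bool
completesᵇ x y C d = avoidsᵇ x y d ∧ C (triple x y d)

verticesThrough : ∀ {n} → Fin n → Fin n → (Subset n → Bool) → ℕ
verticesThrough {n} x y C = countᵇ (λ t → isVertexᵇ t ∧ lookup t x ∧ lookup t y ∧ C t) (allSubsets n)

verticesThrough≡ : ∀ {n} {x y : Fin n} → x ≢ y → (C : Subset n → Bool) →
                   verticesThrough x y C ≡ countᵇ (completesᵇ x y C) (allFin n)
verticesThrough≡ {n} {x} {y} x≢y C =
  countᵇ-image (triple x y) (allSubsets! n) (allFin⁺ n) into injective onto
  where
  into : ∀ {d} → d ∈ allFin n → completesᵇ x y C d ≡ true →
         triple x y d ∈ allSubsets n ×
         (isVertexᵇ (triple x y d) ∧ lookup (triple x y d) x ∧ lookup (triple x y d) y ∧ C (triple x y d)) ≡ true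
  into {d} _ h with d≢x , d≢y , Cd ← avoids-∧⁻ h =
    ∈-allSubsets _ ,
    cong₂ _∧_ (cong (_≡ᵇ 3) (∣triple∣≡3 x≢y (≢-sym d≢x) (≢-sym d≢y)))
              (cong₂ _∧_ (triple-∋₁ x y d) (cong₂ _∧_ (triple-∋₂ x y d) Cd))
  injective : ∀ {d d′} → completesᵇ x y C d ≡ true → completesᵇ x y C d′ ≡ true →
              triple x y d ≡ triple x y d′ → d ≡ d′
  injective {d} {d′} h _ eq with d≢x , d≢y , _ ← avoids-∧⁻ h
    with triple-∋⁻ (trans (cong (λ t → lookup t d) (sym eq)) (triple-∋₃ x y d))
  ... | inj₁ d≡x        = ⊥-elim (d≢x d≡x)
  ... | inj₂ (inj₁ d≡y) = ⊥-elim (d≢y d≡y)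
  ... | inj₂ (inj₂ d≡d′) = d≡d′
  onto : ∀ {t} → t ∈ allSubsets n → (isVertexᵇ t ∧ lookup t x ∧ lookup t y ∧ C t) ≡ true →
         ∃ λ d → d ∈ allFin n × completesᵇ x y C d ≡ true × triple x y d ≡ t
  onto {t} _ h with isVertexᵇ t in vertex | lookup t x in tx | lookup t y in ty
  ... | true | true | true
    with d , d≢x , d≢y , t≡xyd ← triple-through x≢y {t} (≡ᵇ⇒≡ ∣ t ∣ 3 (Equivalence.from T-≡ vertex)) tx ty
    =
    d , ∈-allFin d , trans (cong₂ _∧_ (avoids⁺ d≢x d≢y) (cong C (sym t≡xyd))) h , sym t≡xyd

-- X₁-neighbours of a vertex, grouped by the shared pair

module _ {n : ℕ} (col : Colouring n) where

  -- viaPairᵇ x y z d: the vertex x y d is an X₁-neighbour of x y z sharing exactly {x, y} with it.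
  viaPairᵇ : Fin n → Fin n → Fin n → Fin n → Bool
  viaPairᵇ x y z = completesᵇ x y (λ t → not (lookup t z) ∧ col t)

  pairDegree : Fin n → Fin n → Fin n → ℕ
  pairDegree x y z = countᵇ (viaPairᵇ x y z) (allFin n)

module _ {n : ℕ} (col : Colouring n) {x y z : Fin n} (x≢y : x ≢ y) (x≢z : x ≢ z) (y≢z : y ≢ z) where

  private
    T : Subset n
    T = triple x y z

  viaPair⁻ : ∀ {d} → viaPairᵇ col x y z d ≡ true → d ≢ x × d ≢ y × d ≢ z × col (triple x y d) ≡ true
  viaPair⁻ {d} h
    with d≢x , d≢y , h′ ← avoids-∧⁻ h
    with z∉ , xyd∈X₁ ← not-∧⁻ h′
    = d≢x , d≢y , d≢z , xyd∈X₁
    where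
    d≢z : d ≢ z
    d≢z d≡z = not-¬ z∉ (trans (cong (lookup (triple x y d)) (sym d≡z)) (triple-∋₃ x y d))

  viaPair⁺ : ∀ {d} → d ≢ x → d ≢ y → d ≢ z → col (triple x y d) ≡ true → viaPairᵇ col x y z d ≡ true
  viaPair⁺ d≢x d≢y d≢z xyd∈X₁ =
    cong₂ _∧_ (avoids⁺ d≢x d≢y)
              (cong₂ _∧_ (cong not (triple-∌ (≢-sym x≢z) (≢-sym y≢z) (≢-sym d≢z))) xyd∈X₁)

  pairCount-split : pairCount col x y ≡ ⟦ col T ⟧ + pairDegree col x y z
  pairCount-split = begin
    pairCount col x y                                               ≡⟨ verticesThrough≡ x≢y col ⟩
    countᵇ (completesᵇ x y col) (allFin n)                          ≡⟨ countᵇ-+ pointwise (allFin n) ⟩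
    countᵇ (λ d → (d ≟ᵇ z) ∧ col (triple x y d)) (allFin n) + pairDegree col x y z
      ≡⟨ cong (_+ pairDegree col x y z) (countᵇ-select z (col ∘ triple x y)) ⟩
    ⟦ col T ⟧ + pairDegree col x y z                                 ∎
    where
    open ≡-Reasoning
    pointwise : ∀ d →
      ⟦ completesᵇ x y col d ⟧ ≡ ⟦ (d ≟ᵇ z) ∧ col (triple x y d) ⟧ + ⟦ viaPairᵇ col x y z d ⟧
    pointwise d with d ≟ x | d ≟ y | d ≟ z
    ... | yes refl | _        | yes x≡z  = ⊥-elim (x≢z x≡z)
    ... | yes refl | _        | no _     = refl
    ... | no _     | yes refl | yes y≡z  = ⊥-elim (y≢z y≡z)
    ... | no _     | yes refl | no _     = refl
    ... | no _     | no _     | yes refl rewrite triple-∋₃ x y z = sym (+-identityʳ _)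
    ... | no _     | no _     | no d≢z   rewrite triple-∌ (≢-sym x≢z) (≢-sym y≢z) (≢-sym d≢z) = refl

  private
    outside : ∀ {d} → d ≢ x → d ≢ y → d ≢ z → lookup (∁ T) d ≡ true
    outside {d} d≢x d≢y d≢z = trans (lookup-map d not T) (cong not (triple-∌ d≢x d≢y d≢z))

    viaPair⇒outside : ∀ d → viaPairᵇ col x y z d ≡ true → lookup (∁ T) d ≡ true
    viaPair⇒outside d h with d≢x , d≢y , d≢z , _ ← viaPair⁻ h = outside d≢x d≢y d≢z

    countᵇ-outside : countᵇ (lookup (∁ T)) (allFin n) ≡ n ∸ 3
    countᵇ-outside = begin
      countᵇ (lookup (∁ T)) (allFin n) ≡⟨ ∣∣≡countᵇ-lookup (∁ T) ⟨
      ∣ ∁ T ∣                          ≡⟨ ∣∁p∣≡n∸∣p∣ T ⟩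
      n ∸ ∣ T ∣                        ≡⟨ cong (n ∸_) (∣triple∣≡3 x≢y x≢z y≢z) ⟩
      n ∸ 3                            ∎
      where open ≡-Reasoning

  pairDegree≤n∸3 : pairDegree col x y z ≤ n ∸ 3
  pairDegree≤n∸3 =
    subst (pairDegree col x y z ≤_) countᵇ-outside (countᵇ-mono viaPair⇒outside (allFin n))

  pairDegree≡n∸3⇒full : pairDegree col x y z ≡ n ∸ 3 →
                        ∀ {d} → d ≢ x → d ≢ y → d ≢ z → col (triple x y d) ≡ true
  pairDegree≡n∸3⇒full full {d} d≢x d≢y d≢z =
    proj₂ (proj₂ (proj₂ (viaPair⁻ (countᵇ-mono-≡ viaPair⇒outside (trans full (sym countᵇ-outside))
                                                  (∈-allFin d) (outside d≢x d≢y d≢z)))))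

  pairDegree≡1⇒unique : pairDegree col x y z ≡ 1 →
    ∃ λ d → (d ≢ x × d ≢ y × d ≢ z × col (triple x y d) ≡ true) ×
            (∀ e → e ≢ x → e ≢ y → e ≢ z → col (triple x y e) ≡ true → e ≡ d)
  pairDegree≡1⇒unique one with d , _ , vd , unique ← countᵇ≡1⇒unique one =
    d , viaPair⁻ vd , λ e e≢x e≢y e≢z xye∈X₁ → unique (∈-allFin e) (viaPair⁺ e≢x e≢y e≢z xye∈X₁)

  X₁-degree : nbrsIn col true T ≡ pairDegree col x y z + pairDegree col x z y + pairDegree col y z x
  X₁-degree = begin
    nbrsIn col true T
      ≡⟨ countᵇ-+₃ pointwise (allSubsets n) ⟩
    verticesThrough x y (λ t → not (lookup t z) ∧ col t) + verticesThrough x z (λ t → not (lookup t y) ∧ col t)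
      + verticesThrough y z (λ t → not (lookup t x) ∧ col t)
      ≡⟨ cong₂ _+_ (cong₂ _+_ (verticesThrough≡ x≢y _) (verticesThrough≡ x≢z _)) (verticesThrough≡ y≢z _) ⟩
    pairDegree col x y z + pairDegree col x z y + pairDegree col y z x ∎
    where
    open ≡-Reasoning
    exactlyTwo : ∀ v a b c k → ⟦ v ∧ (⟦ a ⟧ + ⟦ b ⟧ + ⟦ c ⟧ ≡ᵇ 2) ∧ k ⟧ ≡
      ⟦ v ∧ a ∧ b ∧ (not c ∧ k) ⟧ + ⟦ v ∧ a ∧ c ∧ (not b ∧ k) ⟧ + ⟦ v ∧ b ∧ c ∧ (not a ∧ k) ⟧
    exactlyTwo false _     _     _     _     = refl
    exactlyTwo true  true  true  true  _     = refl
    exactlyTwo true  true  true  false true  = refl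
    exactlyTwo true  true  true  false false = refl
    exactlyTwo true  true  false true  true  = refl
    exactlyTwo true  true  false true  false = refl
    exactlyTwo true  true  false false _     = refl
    exactlyTwo true  false true  true  _     = refl
    exactlyTwo true  false true  false _     = refl
    exactlyTwo true  false false true  _     = refl
    exactlyTwo true  false false false _     = refl
    pointwise : ∀ t → ⟦ isVertexᵇ t ∧ adjᵇ T t ∧ col t ⟧ ≡
      ⟦ isVertexᵇ t ∧ lookup t x ∧ lookup t y ∧ (not (lookup t z) ∧ col t) ⟧
      + ⟦ isVertexᵇ t ∧ lookup t x ∧ lookup t z ∧ (not (lookup t y) ∧ col t) ⟧
      + ⟦ isVertexᵇ t ∧ lookup t y ∧ lookup t z ∧ (not (lookup t x) ∧ col t) ⟧
    pointwise t = trans (cong (λ m → ⟦ isVertexᵇ t ∧ (m ≡ᵇ 2) ∧ col t ⟧) (∣triple∩∣ x≢y x≢z y≢z t))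
                        (exactlyTwo (isVertexᵇ t) (lookup t x) (lookup t y) (lookup t z) (col t))

module PairCountsOfX₁Vertex {n : ℕ} (col : Colouring n) {x y z : Fin n}
         (x≢y : x ≢ y) (x≢z : x ≢ z) (y≢z : y ≢ z) (xyz∈X₁ : col (triple x y z) ≡ true) where

  pairCount-xy : pairCount col x y ≡ suc (pairDegree col x y z)
  pairCount-xy = trans (pairCount-split col x≢y x≢z y≢z)
                       (cong (λ b → ⟦ b ⟧ + pairDegree col x y z) xyz∈X₁)

  pairCount-xz : pairCount col x z ≡ suc (pairDegree col x z y)
  pairCount-xz = trans (pairCount-split col x≢z x≢y (≢-sym y≢z))
                       (cong (λ b → ⟦ b ⟧ + pairDegree col x z y)
                             (trans (cong col (triple-swap x y z)) xyz∈X₁))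

  pairCount-yz : pairCount col y z ≡ suc (pairDegree col y z x)
  pairCount-yz = trans (pairCount-split col y≢z (≢-sym x≢y) (≢-sym x≢z))
                       (cong (λ b → ⟦ b ⟧ + pairDegree col y z x)
                             (trans (cong col (triple-rotate x y z)) xyz∈X₁))

degrees-forced : ∀ {n D₁ D₂ D₃} → 6 ≤ n → D₁ ≡ D₂ → D₂ ≡ D₃ + (n ∸ 4) → D₂ ≤ n ∸ 3 →
                 2 * n ≤ D₁ + D₂ + D₃ + 7 → D₃ ≡ 1 × D₂ ≡ n ∸ 3
degrees-forced {D₃ = zero} (s≤s (s≤s (s≤s (s≤s {n = m} _)))) refl refl _ 2n≤ =
  ⊥-elim (1+n≰n (subst (_≤ m + m + 0 + 7) 2n≡1+D+7 2n≤))
  where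
  open +-*-Solver
  2n≡1+D+7 : 2 * (4 + m) ≡ 1 + (m + m + 0 + 7)
  2n≡1+D+7 = solve 1 (λ m → con 2 :* (con 4 :+ m) := con 1 :+ (m :+ m :+ con 0 :+ con 7)) refl m
degrees-forced {D₃ = suc zero} (s≤s (s≤s (s≤s (s≤s _)))) refl refl _ _ = refl , refl
degrees-forced {D₃ = suc (suc k)} (s≤s (s≤s (s≤s (s≤s {n = m} _)))) refl refl (s≤s D₂≤m) _ =
  ⊥-elim (1+n≰n (≤-trans D₂≤m (m≤n+m m k)))

mainTheorem11 : (n : ℕ) → 6 ≤ n → (col : Colouring n) → (p11 p12 p21 p22 : ℕ) →
    IsLambda2Equitable col p11 p12 p21 p22 →
    p22 ≤ p11 → 2 * n ≤ p11 + 7 →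
    (a b c : Fin n) → a ≢ b → a ≢ c → b ≢ c →
    col (triple a b c) ≡ true →
    pairCount col a c ≤ pairCount col a b →
    pairCount col b c ≤ pairCount col a c →
    pairCount col a b ≡ pairCount col a c →
    pairCount col a c ≡ pairCount col b c + (n ∸ 4) →
    ((d : Fin n) → d ≢ a → d ≢ b → d ≢ c →
       col (triple a b d) ≡ true × col (triple a c d) ≡ true)
    × (Σ (Fin n) λ d → (d ≢ a × d ≢ b × d ≢ c × col (triple b c d) ≡ true) ×
         ((e : Fin n) → e ≢ a → e ≢ b → e ≢ c → col (triple b c e) ≡ true → e ≡ d))
mainTheorem11 n 6≤n col p11 _ _ _ ((_ , X₁-row , _) , _) _ 2n≤p11+7
              a b c a≢b a≢c b≢c abc∈X₁ _ _ ab≡ac ac≡bc+n∸4 =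
  let D₃≡1 , D₂≡n∸3 =
        degrees-forced 6≤n D₁≡D₂ D₂≡D₃+n∸4 (pairDegree≤n∸3 col a≢c a≢b (≢-sym b≢c)) 2n≤D+7
      d , (d≢b , d≢c , d≢a , bcd∈X₁) , unique =
        pairDegree≡1⇒unique col b≢c (≢-sym a≢b) (≢-sym a≢c) D₃≡1
  in (λ e e≢a e≢b e≢c → pairDegree≡n∸3⇒full col a≢b a≢c b≢c (trans D₁≡D₂ D₂≡n∸3) e≢a e≢b e≢c
                      , pairDegree≡n∸3⇒full col a≢c a≢b (≢-sym b≢c) D₂≡n∸3 e≢a e≢c e≢b)
     , d , (d≢a , d≢b , d≢c , bcd∈X₁) , λ e e≢a e≢b e≢c → unique e e≢b e≢c e≢a
  where
  open PairCountsOfX₁Vertex col a≢b a≢c b≢c abc∈X₁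
  D₁≡D₂ : pairDegree col a b c ≡ pairDegree col a c b
  D₁≡D₂ = suc-injective (trans (sym pairCount-xy) (trans ab≡ac pairCount-xz))
  D₂≡D₃+n∸4 : pairDegree col a c b ≡ pairDegree col b c a + (n ∸ 4)
  D₂≡D₃+n∸4 = suc-injective (trans (sym pairCount-xz) (trans ac≡bc+n∸4 (cong (_+ (n ∸ 4)) pairCount-yz)))
  2n≤D+7 : 2 * n ≤ pairDegree col a b c + pairDegree col a c b + pairDegree col b c a + 7
  2n≤D+7 = subst (λ p → 2 * n ≤ p + 7)
             (trans (sym (proj₁ (X₁-row _ (∣triple∣≡3 a≢b a≢c b≢c) abc∈X₁)))
                    (X₁-degree col a≢b a≢c b≢c))
             2n≤p11+7
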